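{- For each positive integer $n$, $$\sum_{T\in\mathcal{B}(n)} \prod_{v\in T} \Bigl(1+\frac{1}{2h_v}\Bigr)^{h_v-1} = \frac{(2n+1)^{n-1}}{n!}.$$
   Context: $\mathcal{B}(n)$ denotes the set of all binary trees with $n$ vertices (each vertex has an optional left child and an optional right child, left and right being distinguished). For a vertex $v$ of a binary tree $T$, the hook length $h_v$ is the number of descendants of $v$ in $T$, counting $v$ itself. The product is over all vertices $v$ of $T$. -}

module Defs where

open import Data.Nat as ℕ using (ℕ; zero; suc; _∸_; _!)
open import Data.Nat.Properties using (_!≢0)
open import Data.Integer using (+_)
open import Data.List using (List; []; _∷_; concatMap; map; foldr; upTo)
open import Data.Rational using (ℚ; 0ℚ; 1ℚ; _+_; _*_; _/_)

-- Binary trees: each vertex ('node') has an optional left and an optional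
-- right child; 'leaf' stands for an absent child (the empty tree).
data BTree : Set where
  leaf : BTree
  node : BTree → BTree → BTree

size : BTree → ℕ
size leaf       = 0
size (node l r) = suc (size l ℕ.+ size r)

-- all binary trees with exactly n vertices, computed with fuel
-- (fuel ≥ n suffices); trees (suc n) = node l r with size l = k, size r = n - k
treesF : ℕ → ℕ → List BTree
treesF _          zero    = leaf ∷ []
treesF zero       (suc _) = []
treesF (suc fuel) (suc n) =
  concatMap (λ k → concatMap (λ l → map (node l) (treesF fuel (n ∸ k)))
                             (treesF fuel k))
            (upTo (suc n))

𝓑 : ℕ → List BTree
𝓑 n = treesF n n

_^ℚ_ : ℚ → ℕ → ℚ
q ^ℚ zero  = 1ℚ
q ^ℚ suc k = q * (q ^ℚ k)

-- the factor (1 + 1/(2h))^(h-1) for a hook length h ≥ 1 (h = suc m)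
factor : ℕ → ℚ
factor m = (1ℚ + (+ 1 / (2 ℕ.* suc m))) ^ℚ m

-- ∏_{v ∈ T} (1 + 1/(2 h_v))^(h_v - 1); the hook length of a vertex is the
-- size of the subtree rooted at it
hookProd : BTree → ℚ
hookProd leaf       = 1ℚ
hookProd (node l r) = factor (size l ℕ.+ size r) * (hookProd l * hookProd r)

sumℚ : List ℚ → ℚ
sumℚ = foldr _+_ 0ℚ

rhs : ℕ → ℚ
rhs n = (+ ((2 ℕ.* n ℕ.+ 1) ℕ.^ (n ∸ 1)) / (n !)) {{n !≢0}}

module Submission where

-- Deleting the root of a binary tree with n + 1 vertices leaves subtrees with k and n - k
-- vertices, and the root contributes the factor (1 + 1/(2n+2))^n whatever their shapes. So the
-- sums g(n) of the theorem satisfy g(0) = 1 and g(n+1) = (1 + 1/(2n+2))^n ∑_k g(k) g(n-k).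
-- Writing g(n) = a(n)/n! with a(n) = (2n+1)^(n-1), this recurrence becomes
-- (n+1) ∑_k C(n,k) a(k) a(n-k) = (2n+2)^n, which is Abel's convolution identity
-- ∑_k C(n,k) A_k(x) A_(n-k)(y) = A_n(x+y) for A_k(x) = x (x+ck)^(k-1), at c = 2 and x = y = 1.
-- Abel's identity reduces to its binomial form ∑_k C(n,k) A_k(x) (y + c(n-k))^(n-k) = (x+y+cn)^n.
-- For that, write y + c(n-k) = z - (x+ck) with z = x+y+cn, expand binomially and exchange the
-- sums: the coefficient of z^j is an alternating binomial sum of a polynomial in k of degree less
-- than n - j, which vanishes unless j = n.

open import Defs
open import Data.Nat using (ℕ; _≤_)
open import Data.List using (map)
open import Relation.Binary.PropositionalEquality using (_≡_)

open import Algebra.Bundles using (CommutativeSemiring; CommutativeRing)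
open import Data.Fin using (Fin; toℕ)
open import Data.Nat as ℕ using (zero; suc; _∸_; _!; _<_; z≤n; s≤s; z<s; s<s)
open import Data.Nat.Combinatorics using (_C_; nCk≡n!/k![n-k]!; k>n⇒nCk≡0; nCn≡1; k![n∸k]!∣n!)
import Data.Nat.DivMod as ℕ
import Data.Nat.Properties as ℕ
open import Function using (_∘_; id)

module FiniteSum {c ℓ} (R : CommutativeSemiring c ℓ) where

  open CommutativeSemiring R
  open import Algebra.Definitions.RawSemiring rawSemiring using (_^_; _×_)
  open import Algebra.Properties.CommutativeSemigroup +-commutativeSemigroup using (interchange)
  open import Algebra.Properties.Monoid.Sum +-monoid using (sum)
  import Algebra.Properties.CommutativeSemiring.Binomial R as Binomial
  open import Relation.Binary.Reasoning.Setoid setoid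

  ∑ : ℕ → (ℕ → Carrier) → Carrier
  ∑ zero    f = 0#
  ∑ (suc n) f = f 0 + ∑ n (f ∘ suc)

  syntax ∑ n (λ k → e) = ∑[ k < n ] e

  ∑-cong : ∀ n {f g : ℕ → Carrier} → (∀ {k} → k < n → f k ≈ g k) → ∑ n f ≈ ∑ n g
  ∑-cong zero    f≈g = refl
  ∑-cong (suc n) f≈g = +-cong (f≈g z<s) (∑-cong n (f≈g ∘ s<s))

  ∑-zero : ∀ n {f : ℕ → Carrier} → (∀ {k} → k < n → f k ≈ 0#) → ∑ n f ≈ 0#
  ∑-zero zero    f≈0 = refl
  ∑-zero (suc n) f≈0 = trans (+-cong (f≈0 z<s) (∑-zero n (f≈0 ∘ s<s))) (+-identityˡ 0#)

  ∑-extend : ∀ {m n} {f : ℕ → Carrier} → m ≤ n → (∀ {k} → m ≤ k → f k ≈ 0#) → ∑ n f ≈ ∑ m f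
  ∑-extend {n = n} z≤n       f≈0 = ∑-zero n (λ _ → f≈0 z≤n)
  ∑-extend         (s≤s m≤n) f≈0 = +-congˡ (∑-extend m≤n (f≈0 ∘ s≤s))

  ∑-suc : ∀ n (f : ℕ → Carrier) → ∑ (suc n) f ≈ ∑ n f + f n
  ∑-suc zero    f = +-comm (f 0) 0#
  ∑-suc (suc n) f = begin
    f 0 + ∑ (suc n) (f ∘ suc)     ≈⟨ +-congˡ (∑-suc n (f ∘ suc)) ⟩
    f 0 + (∑ n (f ∘ suc) + f (suc n)) ≈⟨ +-assoc (f 0) _ _ ⟨
    f 0 + ∑ n (f ∘ suc) + f (suc n) ∎

  ∑-distrib-+ : ∀ n (f g : ℕ → Carrier) → ∑[ k < n ] (f k + g k) ≈ ∑ n f + ∑ n g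
  ∑-distrib-+ zero    f g = sym (+-identityˡ 0#)
  ∑-distrib-+ (suc n) f g = trans (+-congˡ (∑-distrib-+ n (f ∘ suc) (g ∘ suc)))
                                  (interchange (f 0) (g 0) _ _)

  *-distribˡ-∑ : ∀ a n (f : ℕ → Carrier) → a * ∑ n f ≈ ∑[ k < n ] (a * f k)
  *-distribˡ-∑ a zero    f = zeroʳ a
  *-distribˡ-∑ a (suc n) f = trans (distribˡ a (f 0) _) (+-congˡ (*-distribˡ-∑ a n (f ∘ suc)))

  ∑-comm : ∀ m n (f : ℕ → ℕ → Carrier) → ∑[ i < m ] ∑[ j < n ] f i j ≈ ∑[ j < n ] ∑[ i < m ] f i j
  ∑-comm zero    n f = sym (∑-zero n (λ _ → refl))
  ∑-comm (suc m) n f = begin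
    ∑ n (f 0) + ∑[ i < m ] ∑ n (f (suc i))          ≈⟨ +-congˡ (∑-comm m n (f ∘ suc)) ⟩
    ∑ n (f 0) + ∑[ j < n ] ∑[ i < m ] f (suc i) j   ≈⟨ ∑-distrib-+ n (f 0) _ ⟨
    ∑[ j < n ] (f 0 j + ∑[ i < m ] f (suc i) j)     ∎

  ∑≈sum : ∀ n (f : ℕ → Carrier) → ∑ n f ≈ sum (λ (i : Fin n) → f (toℕ i))
  ∑≈sum zero    f = refl
  ∑≈sum (suc n) f = +-congˡ (∑≈sum n (f ∘ suc))

  binomial : ∀ n x y → (x + y) ^ n ≈ ∑[ k < suc n ] ((n C k) × (x ^ k * y ^ (n ∸ k)))
  binomial n x y = trans (Binomial.theorem n x y) (sym (∑≈sum (suc n) (λ k → (n C k) × (x ^ k * y ^ (n ∸ k)))))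

module BinomialCoefficients where

  open import Data.Nat using (_*_; _+_)
  open import Data.Nat.Properties
  open import Relation.Binary.PropositionalEquality using (refl; sym; trans; cong; cong₂; module ≡-Reasoning)
  open import Relation.Nullary using (yes; no)
  open ≡-Reasoning
  open import Data.Nat.Tactic.RingSolver using (solve-∀)
  open import Algebra.Properties.CommutativeSemigroup *-commutativeSemigroup using (x∙yz≈y∙xz)

  C-factorial : ∀ {n k} → k ≤ n → (n C k) * (k ! * (n ∸ k) !) ≡ n !
  C-factorial {n} {k} k≤n = trans (cong (_* (k ! * (n ∸ k) !)) (nCk≡n!/k![n-k]! k≤n))
                                  (ℕ.m/n*n≡m {{k !* (n ∸ k) !≢0}} (k![n∸k]!∣n! k≤n))

  private
    cancel-factorials : ∀ {a b} k m → a * (k ! * m !) ≡ b * (k ! * m !) → a ≡ b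
    cancel-factorials {a} {b} k m = *-cancelʳ-≡ a b (k ! * m !) {{k !* m !≢0}}

  C-absorb : ∀ n k → suc k * (suc n C suc k) ≡ suc n * (n C k)
  C-absorb n k with k ≤? n
  ... | no  k≰n = begin
    suc k * (suc n C suc k) ≡⟨ cong (suc k *_) (k>n⇒nCk≡0 (s≤s (≰⇒> k≰n))) ⟩
    suc k * 0               ≡⟨ *-zeroʳ (suc k) ⟩
    0                       ≡⟨ *-zeroʳ (suc n) ⟨
    suc n * 0               ≡⟨ cong (suc n *_) (k>n⇒nCk≡0 (≰⇒> k≰n)) ⟨
    suc n * (n C k)         ∎
  ... | yes k≤n = cancel-factorials k (n ∸ k) (begin
    suc k * (suc n C suc k) * (k ! * (n ∸ k) !)   ≡⟨ shuffle (suc k) (suc n C suc k) (k !) ((n ∸ k) !) ⟩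
    (suc n C suc k) * (suc k ! * (n ∸ k) !)       ≡⟨ C-factorial (s≤s k≤n) ⟩
    suc n !                                       ≡⟨ cong (suc n *_) (C-factorial k≤n) ⟨
    suc n * ((n C k) * (k ! * (n ∸ k) !))        ≡⟨ *-assoc (suc n) (n C k) (k ! * (n ∸ k) !) ⟨
    suc n * (n C k) * (k ! * (n ∸ k) !)           ∎)
    where
    shuffle : ∀ a b c d → a * b * (c * d) ≡ b * (a * c * d)
    shuffle = solve-∀

  C-∸-absorb : ∀ n k → (suc n ∸ k) * (suc n C k) ≡ suc n * (n C k)
  C-∸-absorb n k with k ≤? n
  ... | no  k≰n = begin
    (suc n ∸ k) * (suc n C k) ≡⟨ cong (_* (suc n C k)) (m≤n⇒m∸n≡0 (≰⇒> k≰n)) ⟩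
    0                         ≡⟨ *-zeroʳ (suc n) ⟨
    suc n * 0                 ≡⟨ cong (suc n *_) (k>n⇒nCk≡0 (≰⇒> k≰n)) ⟨
    suc n * (n C k)           ∎
  ... | yes k≤n = cancel-factorials k (n ∸ k) (begin
    (suc n ∸ k) * (suc n C k) * (k ! * (n ∸ k) !)   ≡⟨ shuffle (suc n ∸ k) (suc n C k) (k !) ((n ∸ k) !) ⟩
    (suc n C k) * (k ! * ((suc n ∸ k) * (n ∸ k) !)) ≡⟨ cong (λ m → (suc n C k) * (k ! * (m * (n ∸ k) !))) [n+1-k]≡1+[n-k] ⟩
    (suc n C k) * (k ! * suc (n ∸ k) !)             ≡⟨ cong (λ m → (suc n C k) * (k ! * m !)) [n+1-k]≡1+[n-k] ⟨
    (suc n C k) * (k ! * (suc n ∸ k) !)             ≡⟨ C-factorial (m≤n⇒m≤1+n k≤n) ⟩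
    suc n !                                         ≡⟨ cong (suc n *_) (C-factorial k≤n) ⟨
    suc n * ((n C k) * (k ! * (n ∸ k) !))           ≡⟨ *-assoc (suc n) (n C k) (k ! * (n ∸ k) !) ⟨
    suc n * (n C k) * (k ! * (n ∸ k) !)             ∎)
    where
    [n+1-k]≡1+[n-k] : suc n ∸ k ≡ suc (n ∸ k)
    [n+1-k]≡1+[n-k] = +-∸-assoc 1 k≤n
    shuffle : ∀ a b c d → a * b * (c * d) ≡ b * (c * (a * d))
    shuffle = solve-∀

  ∸-swap : ∀ n k j → n ∸ k ∸ j ≡ n ∸ j ∸ k
  ∸-swap n k j = trans (∸-+-assoc n k j) (trans (cong (n ∸_) (+-comm k j)) (sym (∸-+-assoc n j k)))

  private
    C-C-vanish : ∀ {n k j} → n < k + j → (n C j) * ((n ∸ j) C k) ≡ 0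
    C-C-vanish {n} {k} {j} n<k+j with j ≤? n
    ... | no  j≰n = cong (_* ((n ∸ j) C k)) (k>n⇒nCk≡0 (≰⇒> j≰n))
    ... | yes j≤n = trans (cong ((n C j) *_) (k>n⇒nCk≡0 n∸j<k)) (*-zeroʳ (n C j))
      where
      n∸j<k : n ∸ j < k
      n∸j<k = <-≤-trans (∸-monoˡ-< n<k+j j≤n) (≤-reflexive (m+n∸n≡m k j))

    C-C-factorial : ∀ {n k j} → k + j ≤ n → (n C k) * ((n ∸ k) C j) * (k ! * (j ! * (n ∸ k ∸ j) !)) ≡ n !
    C-C-factorial {n} {k} {j} k+j≤n = begin
      (n C k) * ((n ∸ k) C j) * (k ! * (j ! * (n ∸ k ∸ j) !))   ≡⟨ shuffle (n C k) ((n ∸ k) C j) (k !) (j !) ((n ∸ k ∸ j) !) ⟩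
      (n C k) * (k ! * (((n ∸ k) C j) * (j ! * (n ∸ k ∸ j) !))) ≡⟨ cong (λ m → (n C k) * (k ! * m)) (C-factorial j≤n∸k) ⟩
      (n C k) * (k ! * (n ∸ k) !)                               ≡⟨ C-factorial (≤-trans (m≤m+n k j) k+j≤n) ⟩
      n !                                                       ∎
      where
      j≤n∸k : j ≤ n ∸ k
      j≤n∸k = m+n≤o⇒m≤o∸n j (≤-trans (≤-reflexive (+-comm j k)) k+j≤n)
      shuffle : ∀ a b c d e → a * b * (c * (d * e)) ≡ a * (c * (b * (d * e)))
      shuffle = solve-∀

  C-trinomial : ∀ n k j → (n C k) * ((n ∸ k) C j) ≡ (n C j) * ((n ∸ j) C k)
  C-trinomial n k j with k + j ≤? n
  ... | no  k+j≰n = trans (C-C-vanish {n} {j} {k} (≤-trans (≰⇒> k+j≰n) (≤-reflexive (+-comm k j))))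
                          (sym (C-C-vanish {n} {k} {j} (≰⇒> k+j≰n)))
  ... | yes k+j≤n = *-cancelʳ-≡ _ _ (k ! * (j ! * (n ∸ k ∸ j) !)) {{nonZero}} (begin
    (n C k) * ((n ∸ k) C j) * (k ! * (j ! * (n ∸ k ∸ j) !)) ≡⟨ C-C-factorial {n} {k} {j} k+j≤n ⟩
    n !                                                     ≡⟨ C-C-factorial {n} {j} {k} (≤-trans (≤-reflexive (+-comm j k)) k+j≤n) ⟨
    (n C j) * ((n ∸ j) C k) * (j ! * (k ! * (n ∸ j ∸ k) !)) ≡⟨ cong (λ m → (n C j) * ((n ∸ j) C k) * m) factorials-comm ⟩
    (n C j) * ((n ∸ j) C k) * (k ! * (j ! * (n ∸ k ∸ j) !)) ∎)
    where
    nonZero = m*n≢0 (k !) (j ! * (n ∸ k ∸ j) !) {{k !≢0}} {{j !* (n ∸ k ∸ j) !≢0}}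
    factorials-comm : j ! * (k ! * (n ∸ j ∸ k) !) ≡ k ! * (j ! * (n ∸ k ∸ j) !)
    factorials-comm = trans (cong (λ m → j ! * (k ! * m !)) (∸-swap n j k)) (x∙yz≈y∙xz (j !) (k !) _)

rhs-numerator : ℕ → ℕ
rhs-numerator n = (2 ℕ.* n ℕ.+ 1) ℕ.^ (n ∸ 1)

module AbelIdentities where

  open import Data.Integer using (ℤ; +_; -_; _+_; _*_; _^_; -1ℤ; 0ℤ; 1ℤ)
  open import Data.Integer.Properties
  open import Data.Integer.Tactic.RingSolver using (solve-∀)
  open import Algebra.Definitions.RawSemiring (CommutativeSemiring.rawSemiring +-*-commutativeSemiring)
    using () renaming (_^_ to _^ᴿ_; _×_ to _×ᴿ_)
  open import Relation.Binary.PropositionalEquality using (refl; sym; trans; cong; cong₂; module ≡-Reasoning)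
  open ≡-Reasoning
  open BinomialCoefficients
  open FiniteSum +-*-commutativeSemiring
    using (∑; ∑-cong; ∑-zero; ∑-extend; ∑-suc; ∑-distrib-+; *-distribˡ-∑; ∑-comm; binomial)

  ×ᴿ≡* : ∀ n x → n ×ᴿ x ≡ + n * x
  ×ᴿ≡* zero    x = sym (*-zeroˡ x)
  ×ᴿ≡* (suc n) x = trans (cong (λ t → x + t) (×ᴿ≡* n x)) (sym (suc-* (+ n) x))

  ^ᴿ≡^ : ∀ x n → x ^ᴿ n ≡ x ^ n
  ^ᴿ≡^ x zero    = refl
  ^ᴿ≡^ x (suc n) = cong (x *_) (^ᴿ≡^ x n)

  pos-^ : ∀ m n → + (m ℕ.^ n) ≡ (+ m) ^ n
  pos-^ m zero    = refl
  pos-^ m (suc n) = trans (pos-* m (m ℕ.^ n)) (cong (+ m *_) (pos-^ m n))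

  pos-∸ : ∀ {m n} → n ≤ m → + (m ∸ n) ≡ + m + - + n
  pos-∸ {m} {n} n≤m = sym (trans (m-n≡m⊖n m n) (⊖-≥ n≤m))

  -‿^ : ∀ x n → (- x) ^ n ≡ -1ℤ ^ n * x ^ n
  -‿^ x zero    = refl
  -‿^ x (suc n) = trans (cong (- x *_) (-‿^ x n)) (shuffle x (-1ℤ ^ n) (x ^ n))
    where
    shuffle : ∀ x s p → - x * (s * p) ≡ -1ℤ * s * (x * p)
    shuffle = solve-∀

  -1^∸ : ∀ {m k} → k ≤ m → -1ℤ ^ (m ∸ k) ≡ -1ℤ ^ m * -1ℤ ^ k
  -1^∸ {m} {k} k≤m = begin
    -1ℤ ^ (m ∸ k)                          ≡⟨ *-identityʳ _ ⟨
    -1ℤ ^ (m ∸ k) * 1ℤ                     ≡⟨ cong (-1ℤ ^ (m ∸ k) *_) (-1^-square k) ⟨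
    -1ℤ ^ (m ∸ k) * (-1ℤ ^ k * -1ℤ ^ k)    ≡⟨ *-assoc (-1ℤ ^ (m ∸ k)) _ _ ⟨
    -1ℤ ^ (m ∸ k) * -1ℤ ^ k * -1ℤ ^ k      ≡⟨ cong (_* -1ℤ ^ k) (^-distribˡ-+-* -1ℤ (m ∸ k) k) ⟨
    -1ℤ ^ (m ∸ k ℕ.+ k) * -1ℤ ^ k          ≡⟨ cong (λ e → -1ℤ ^ e * -1ℤ ^ k) (ℕ.m∸n+n≡m k≤m) ⟩
    -1ℤ ^ m * -1ℤ ^ k                      ∎
    where
    -1^-square : ∀ k → -1ℤ ^ k * -1ℤ ^ k ≡ 1ℤ
    -1^-square zero    = refl
    -1^-square (suc k) = trans (square-neg (-1ℤ ^ k)) (-1^-square k)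
      where
      square-neg : ∀ s → -1ℤ * s * (-1ℤ * s) ≡ s * s
      square-neg = solve-∀

  binomialℤ : ∀ n a b → (a + b) ^ n ≡ ∑[ k < suc n ] (+ (n C k) * (a ^ k * b ^ (n ∸ k)))
  binomialℤ n a b = begin
    (a + b) ^ n ≡⟨ ^ᴿ≡^ (a + b) n ⟨
    (a + b) ^ᴿ n ≡⟨ binomial n a b ⟩
    ∑[ k < suc n ] ((n C k) ×ᴿ (a ^ᴿ k * b ^ᴿ (n ∸ k)))
      ≡⟨ ∑-cong (suc n) (λ {k} _ → trans (×ᴿ≡* (n C k) _) (cong (+ (n C k) *_) (cong₂ _*_ (^ᴿ≡^ a k) (^ᴿ≡^ b (n ∸ k))))) ⟩
    ∑[ k < suc n ] (+ (n C k) * (a ^ k * b ^ (n ∸ k))) ∎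

  ∑-C-extend : ∀ {m N} (f : ℕ → ℤ) → m ≤ N → ∑[ k < suc N ] (+ (m C k) * f k) ≡ ∑[ k < suc m ] (+ (m C k) * f k)
  ∑-C-extend {m} f m≤N = ∑-extend (s≤s m≤N) (λ {k} m<k → trans (cong (λ c → + c * f k) (k>n⇒nCk≡0 m<k)) (*-zeroˡ (f k)))

  binomialℤ-≤ : ∀ {m N} a b → m ≤ N → (a + b) ^ m ≡ ∑[ j < suc N ] (+ (m C j) * (a ^ j * b ^ (m ∸ j)))
  binomialℤ-≤ {m} a b m≤N = trans (binomialℤ m a b) (sym (∑-C-extend (λ j → a ^ j * b ^ (m ∸ j)) m≤N))

  -- (-1)^m times the m-th forward difference, with step c, of t ↦ t^r at x.
  Δ : ℤ → ℕ → ℕ → ℤ → ℤ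
  Δ c m r x = ∑[ k < suc m ] (+ (m C k) * (-1ℤ ^ k * (x + c * + k) ^ r))

  Δ-vanish : ∀ c {m r} x → r < m → Δ c m r x ≡ 0ℤ
  Δ-vanish c {suc m} {zero} x _ = begin
    Δ c (suc m) 0 x
      ≡⟨ ∑-cong (suc (suc m)) (λ {k} _ → cong (λ t → + (suc m C k) * (-1ℤ ^ k * t)) (^-zeroˡ (suc m ∸ k))) ⟨
    ∑[ k < suc (suc m) ] (+ (suc m C k) * (-1ℤ ^ k * 1ℤ ^ (suc m ∸ k))) ≡⟨ binomialℤ (suc m) -1ℤ 1ℤ ⟨
    0ℤ ^ suc m                                                         ≡⟨ *-zeroˡ (0ℤ ^ m) ⟩
    0ℤ                                                                 ∎
  Δ-vanish c {suc m} {suc r} x (s≤s r<m) = begin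
    Δ c (suc m) (suc r) x
      ≡⟨ ∑-cong (suc (suc m)) (λ {k} _ → split (+ (suc m C k)) (-1ℤ ^ k) x c (+ k) ((x + c * + k) ^ r)) ⟩
    ∑[ k < suc (suc m) ] (x * F k + c * G k)              ≡⟨ ∑-distrib-+ (suc (suc m)) (λ k → x * F k) (λ k → c * G k) ⟩
    ∑[ k < suc (suc m) ] (x * F k) + ∑[ k < suc (suc m) ] (c * G k)
      ≡⟨ cong₂ _+_ (*-distribˡ-∑ x (suc (suc m)) F) (*-distribˡ-∑ c (suc (suc m)) G) ⟨
    x * Δ c (suc m) r x + c * ∑ (suc (suc m)) G           ≡⟨ cong₂ (λ a b → x * a + c * b) (Δ-vanish c x (ℕ.m<n⇒m<1+n r<m)) ∑G≡0 ⟩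
    x * 0ℤ + c * 0ℤ                                        ≡⟨ cong₂ _+_ (*-zeroʳ x) (*-zeroʳ c) ⟩
    0ℤ                                                     ∎
    where
    F G : ℕ → ℤ
    F k = + (suc m C k) * (-1ℤ ^ k * (x + c * + k) ^ r)
    G k = + (suc m C k) * (-1ℤ ^ k * (+ k * (x + c * + k) ^ r))
    split : ∀ b s x c k p → b * (s * ((x + c * k) * p)) ≡ x * (b * (s * p)) + c * (b * (s * (k * p)))
    split = solve-∀
    H : ℕ → ℤ
    H j = + (m C j) * (-1ℤ ^ j * ((x + c) + c * + j) ^ r)
    G-suc : ∀ j → G (suc j) ≡ - + suc m * H j
    G-suc j = begin
      + (suc m C suc j) * (-1ℤ * -1ℤ ^ j * (+ suc j * (x + c * + suc j) ^ r))
        ≡⟨ cong (λ t → + (suc m C suc j) * (-1ℤ * -1ℤ ^ j * (+ suc j * t ^ r))) (shift x c (+ j)) ⟩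
      + (suc m C suc j) * (-1ℤ * -1ℤ ^ j * (+ suc j * ((x + c) + c * + j) ^ r))
        ≡⟨ regroup (+ (suc m C suc j)) (-1ℤ ^ j) (+ suc j) (((x + c) + c * + j) ^ r) ⟩
      - (+ suc j * + (suc m C suc j)) * (-1ℤ ^ j * ((x + c) + c * + j) ^ r)
        ≡⟨ cong (λ t → - t * (-1ℤ ^ j * ((x + c) + c * + j) ^ r)) absorbℤ ⟩
      - (+ suc m * + (m C j)) * (-1ℤ ^ j * ((x + c) + c * + j) ^ r)
        ≡⟨ regroup′ (+ suc m) (+ (m C j)) (-1ℤ ^ j * ((x + c) + c * + j) ^ r) ⟩
      - + suc m * H j ∎
      where
      shift : ∀ x c j → x + c * (1ℤ + j) ≡ (x + c) + c * j
      shift = solve-∀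
      regroup : ∀ b s k p → b * (-1ℤ * s * (k * p)) ≡ - (k * b) * (s * p)
      regroup = solve-∀
      regroup′ : ∀ a b q → - (a * b) * q ≡ - a * (b * q)
      regroup′ = solve-∀
      absorbℤ : + suc j * + (suc m C suc j) ≡ + suc m * + (m C j)
      absorbℤ = trans (sym (pos-* (suc j) _)) (trans (cong +_ (C-absorb m j)) (pos-* (suc m) (m C j)))
    ∑G≡0 : ∑ (suc (suc m)) G ≡ 0ℤ
    ∑G≡0 = begin
      G 0 + ∑[ j < suc m ] G (suc j)          ≡⟨ cong₂ _+_ G-zero (∑-cong (suc m) (λ {j} _ → G-suc j)) ⟩
      0ℤ + ∑[ j < suc m ] (- + suc m * H j)   ≡⟨ +-identityˡ _ ⟩
      ∑[ j < suc m ] (- + suc m * H j)        ≡⟨ *-distribˡ-∑ (- + suc m) (suc m) H ⟨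
      - + suc m * Δ c m r (x + c)             ≡⟨ cong (- + suc m *_) (Δ-vanish c (x + c) r<m) ⟩
      - + suc m * 0ℤ                          ≡⟨ *-zeroʳ (- + suc m) ⟩
      0ℤ                                      ∎
      where
      G-zero : G 0 ≡ 0ℤ
      G-zero = cong (λ t → 1ℤ * (1ℤ * t)) (*-zeroˡ ((x + c * 0ℤ) ^ r))

  abel : ℤ → ℤ → ℕ → ℤ
  abel c x zero    = 1ℤ
  abel c x (suc k) = x * (x + c * + suc k) ^ k

  abel-*-^ : ∀ c x {k M} → k ≤ suc M → abel c x k * (x + c * + k) ^ (suc M ∸ k) ≡ x * (x + c * + k) ^ M
  abel-*-^ c x {zero} {M} _ = begin
    1ℤ * ((x + c * 0ℤ) * (x + c * 0ℤ) ^ M) ≡⟨ *-identityˡ _ ⟩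
    (x + c * 0ℤ) * (x + c * 0ℤ) ^ M       ≡⟨ cong (_* (x + c * 0ℤ) ^ M) (x+c*0≡x x c) ⟩
    x * (x + c * 0ℤ) ^ M                  ∎
    where
    x+c*0≡x : ∀ x c → x + c * 0ℤ ≡ x
    x+c*0≡x = solve-∀
  abel-*-^ c x {suc j} {M} (s≤s j≤M) = begin
    x * u ^ j * u ^ (M ∸ j)   ≡⟨ *-assoc x (u ^ j) (u ^ (M ∸ j)) ⟩
    x * (u ^ j * u ^ (M ∸ j)) ≡⟨ cong (x *_) (^-distribˡ-+-* u j (M ∸ j)) ⟨
    x * u ^ (j ℕ.+ (M ∸ j))   ≡⟨ cong (λ e → x * u ^ e) (ℕ.m+[n∸m]≡n j≤M) ⟩
    x * u ^ M                 ∎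
    where u = x + c * + suc j

  abel-vanish : ∀ c x M → ∑[ k < suc (suc M) ] (+ (suc M C k) * (abel c x k * (- (x + c * + k)) ^ (suc M ∸ k))) ≡ 0ℤ
  abel-vanish c x M = begin
    ∑[ k < suc (suc M) ] (+ (suc M C k) * (abel c x k * (- (x + c * + k)) ^ (suc M ∸ k)))
      ≡⟨ ∑-cong (suc (suc M)) (λ {k} k<2+M → term k (ℕ.≤-pred k<2+M)) ⟩
    ∑[ k < suc (suc M) ] (σ * (+ (suc M C k) * (-1ℤ ^ k * (x + c * + k) ^ M)))
      ≡⟨ *-distribˡ-∑ σ (suc (suc M)) (λ k → + (suc M C k) * (-1ℤ ^ k * (x + c * + k) ^ M)) ⟨
    σ * Δ c (suc M) M x ≡⟨ cong (σ *_) (Δ-vanish c x (ℕ.n<1+n M)) ⟩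
    σ * 0ℤ              ≡⟨ *-zeroʳ σ ⟩
    0ℤ                  ∎
    where
    σ = -1ℤ ^ suc M * x
    term : ∀ k → k ≤ suc M →
      + (suc M C k) * (abel c x k * (- (x + c * + k)) ^ (suc M ∸ k)) ≡ σ * (+ (suc M C k) * (-1ℤ ^ k * (x + c * + k) ^ M))
    term k k≤1+M = begin
      b * (abel c x k * (- u) ^ (suc M ∸ k))                       ≡⟨ cong (λ t → b * (abel c x k * t)) (-‿^ u (suc M ∸ k)) ⟩
      b * (abel c x k * (-1ℤ ^ (suc M ∸ k) * u ^ (suc M ∸ k)))     ≡⟨ cong (λ s → b * (abel c x k * (s * u ^ (suc M ∸ k)))) (-1^∸ k≤1+M) ⟩
      b * (abel c x k * (-1ℤ ^ suc M * -1ℤ ^ k * u ^ (suc M ∸ k))) ≡⟨ regroup b (abel c x k) (-1ℤ ^ suc M) (-1ℤ ^ k) (u ^ (suc M ∸ k)) ⟩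
      -1ℤ ^ suc M * (b * (-1ℤ ^ k * (abel c x k * u ^ (suc M ∸ k)))) ≡⟨ cong (λ t → -1ℤ ^ suc M * (b * (-1ℤ ^ k * t))) (abel-*-^ c x k≤1+M) ⟩
      -1ℤ ^ suc M * (b * (-1ℤ ^ k * (x * u ^ M)))                  ≡⟨ regroup′ (-1ℤ ^ suc M) b (-1ℤ ^ k) x (u ^ M) ⟩
      σ * (b * (-1ℤ ^ k * u ^ M))                                  ∎
      where
      b = + (suc M C k)
      u = x + c * + k
      regroup : ∀ b a σ s p → b * (a * (σ * s * p)) ≡ σ * (b * (s * (a * p)))
      regroup = solve-∀
      regroup′ : ∀ σ b s x p → σ * (b * (s * (x * p))) ≡ σ * x * (b * (s * p))
      regroup′ = solve-∀

  abel-binomial : ∀ c x y n →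
    ∑[ k < suc n ] (+ (n C k) * (abel c x k * (y + c * + (n ∸ k)) ^ (n ∸ k))) ≡ (x + y + c * + n) ^ n
  abel-binomial c x y n = begin
    ∑[ k < suc n ] (+ (n C k) * (abel c x k * (y + c * + (n ∸ k)) ^ (n ∸ k)))
      ≡⟨ ∑-cong (suc n) (λ {k} k<1+n → expand k (ℕ.≤-pred k<1+n)) ⟩
    ∑[ k < suc n ] ∑[ j < suc n ] T k j              ≡⟨ ∑-comm (suc n) (suc n) T ⟩
    ∑[ j < suc n ] ∑[ k < suc n ] T k j              ≡⟨ ∑-cong (suc n) (λ {j} _ → collect j) ⟩
    ∑[ j < suc n ] (+ (n C j) * z ^ j * V (n ∸ j))   ≡⟨ ∑-suc n (λ j → + (n C j) * z ^ j * V (n ∸ j)) ⟩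
    ∑[ j < n ] (+ (n C j) * z ^ j * V (n ∸ j)) + + (n C n) * z ^ n * V (n ∸ n)
      ≡⟨ cong₂ _+_ (∑-zero n (λ {j} j<n → lower-term j j<n)) top-term ⟩
    0ℤ + z ^ n                                       ≡⟨ +-identityˡ (z ^ n) ⟩
    z ^ n                                            ∎
    where
    z = x + y + c * + n
    u : ℕ → ℤ
    u k = x + c * + k
    T : ℕ → ℕ → ℤ
    T k j = + (n C k) * + ((n ∸ k) C j) * (z ^ j * (abel c x k * (- u k) ^ (n ∸ k ∸ j)))
    V : ℕ → ℤ
    V M = ∑[ k < suc M ] (+ (M C k) * (abel c x k * (- u k) ^ (M ∸ k)))

    expand : ∀ k → k ≤ n → + (n C k) * (abel c x k * (y + c * + (n ∸ k)) ^ (n ∸ k)) ≡ ∑[ j < suc n ] T k j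
    expand k k≤n = begin
      + (n C k) * (abel c x k * (y + c * + (n ∸ k)) ^ (n ∸ k))
        ≡⟨ cong (λ t → + (n C k) * (abel c x k * t ^ (n ∸ k))) y+c[n-k]≡z-u ⟩
      + (n C k) * (abel c x k * (z + - u k) ^ (n ∸ k))
        ≡⟨ cong (λ t → + (n C k) * (abel c x k * t)) (binomialℤ-≤ z (- u k) (ℕ.m∸n≤m n k)) ⟩
      + (n C k) * (abel c x k * ∑[ j < suc n ] B j)   ≡⟨ *-assoc (+ (n C k)) (abel c x k) (∑ (suc n) B) ⟨
      + (n C k) * abel c x k * ∑[ j < suc n ] B j     ≡⟨ *-distribˡ-∑ (+ (n C k) * abel c x k) (suc n) B ⟩
      ∑[ j < suc n ] (+ (n C k) * abel c x k * B j)   ≡⟨ ∑-cong (suc n) (λ {j} _ → regroup (+ (n C k)) (abel c x k) (+ ((n ∸ k) C j)) (z ^ j) ((- u k) ^ (n ∸ k ∸ j))) ⟩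
      ∑[ j < suc n ] T k j                             ∎
      where
      B : ℕ → ℤ
      B j = + ((n ∸ k) C j) * (z ^ j * (- u k) ^ (n ∸ k ∸ j))
      y+c[n-k]≡z-u : y + c * + (n ∸ k) ≡ z + - u k
      y+c[n-k]≡z-u = trans (cong (λ t → y + c * t) (pos-∸ k≤n)) (shift x y c (+ n) (+ k))
        where
        shift : ∀ x y c n k → y + c * (n + - k) ≡ x + y + c * n + - (x + c * k)
        shift = solve-∀
      regroup : ∀ a b d e p → a * b * (d * (e * p)) ≡ a * d * (e * (b * p))
      regroup = solve-∀

    collect : ∀ j → ∑[ k < suc n ] T k j ≡ + (n C j) * z ^ j * V (n ∸ j)
    collect j = begin
      ∑[ k < suc n ] T k j                  ≡⟨ ∑-cong (suc n) (λ {k} _ → swap k) ⟩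
      ∑[ k < suc n ] (+ (n C j) * z ^ j * W k)   ≡⟨ *-distribˡ-∑ (+ (n C j) * z ^ j) (suc n) W ⟨
      + (n C j) * z ^ j * ∑[ k < suc n ] W k     ≡⟨ cong (+ (n C j) * z ^ j *_) (∑-C-extend (λ k → abel c x k * (- u k) ^ (n ∸ j ∸ k)) (ℕ.m∸n≤m n j)) ⟩
      + (n C j) * z ^ j * V (n ∸ j)              ∎
      where
      W : ℕ → ℤ
      W k = + ((n ∸ j) C k) * (abel c x k * (- u k) ^ (n ∸ j ∸ k))
      swap : ∀ k → T k j ≡ + (n C j) * z ^ j * W k
      swap k = begin
        + (n C k) * + ((n ∸ k) C j) * (z ^ j * (abel c x k * (- u k) ^ (n ∸ k ∸ j)))
          ≡⟨ cong₂ (λ b e → b * (z ^ j * (abel c x k * (- u k) ^ e))) trinomialℤ (∸-swap n k j) ⟩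
        + (n C j) * + ((n ∸ j) C k) * (z ^ j * (abel c x k * (- u k) ^ (n ∸ j ∸ k)))
          ≡⟨ regroup (+ (n C j)) (+ ((n ∸ j) C k)) (z ^ j) (abel c x k * (- u k) ^ (n ∸ j ∸ k)) ⟩
        + (n C j) * z ^ j * W k ∎
        where
        trinomialℤ : + (n C k) * + ((n ∸ k) C j) ≡ + (n C j) * + ((n ∸ j) C k)
        trinomialℤ = trans (sym (pos-* (n C k) _)) (trans (cong +_ (C-trinomial n k j)) (pos-* (n C j) _))
        regroup : ∀ a b e q → a * b * (e * q) ≡ a * e * (b * q)
        regroup = solve-∀

    lower-term : ∀ j → j < n → + (n C j) * z ^ j * V (n ∸ j) ≡ 0ℤ
    lower-term j j<n = begin
      + (n C j) * z ^ j * V (n ∸ j)           ≡⟨ cong (λ M → + (n C j) * z ^ j * V M) (ℕ.+-∸-assoc 1 j<n) ⟩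
      + (n C j) * z ^ j * V (suc (n ∸ suc j)) ≡⟨ cong (+ (n C j) * z ^ j *_) (abel-vanish c x (n ∸ suc j)) ⟩
      + (n C j) * z ^ j * 0ℤ                  ≡⟨ *-zeroʳ (+ (n C j) * z ^ j) ⟩
      0ℤ                                      ∎

    top-term : + (n C n) * z ^ n * V (n ∸ n) ≡ z ^ n
    top-term = begin
      + (n C n) * z ^ n * V (n ∸ n) ≡⟨ cong₂ (λ b M → + b * z ^ n * V M) (nCn≡1 n) (ℕ.n∸n≡0 n) ⟩
      1ℤ * z ^ n * 1ℤ               ≡⟨ trans (*-identityʳ (1ℤ * z ^ n)) (*-identityˡ (z ^ n)) ⟩
      z ^ n                         ∎

  abel-split : ∀ c y m → abel c y m ≡ (y + c * + m) ^ m + - (c * (+ m * (y + c * + m) ^ (m ∸ 1)))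
  abel-split c y zero    = split₀ c
    where
    split₀ : ∀ c → 1ℤ ≡ 1ℤ + - (c * (0ℤ * 1ℤ))
    split₀ = solve-∀
  abel-split c y (suc m) = split y c (+ suc m) ((y + c * + suc m) ^ m)
    where
    split : ∀ y c k p → y * p ≡ (y + c * k) * p + - (c * (k * p))
    split = solve-∀

  abel-convolution : ∀ c x y n → ∑[ k < suc n ] (+ (n C k) * (abel c x k * abel c y (n ∸ k))) ≡ abel c (x + y) n
  abel-convolution c x y zero    = refl
  abel-convolution c x y (suc m) = begin
    ∑[ k < suc N ] (+ (N C k) * (abel c x k * abel c y (N ∸ k)))
      ≡⟨ ∑-cong (suc N) (λ {k} _ → split k) ⟩
    ∑[ k < suc N ] (P k + - c * Q k)                 ≡⟨ ∑-distrib-+ (suc N) P (λ k → - c * Q k) ⟩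
    ∑ (suc N) P + ∑[ k < suc N ] (- c * Q k)         ≡⟨ cong (λ t → ∑ (suc N) P + t) (*-distribˡ-∑ (- c) (suc N) Q) ⟨
    ∑ (suc N) P + - c * ∑ (suc N) Q                  ≡⟨ cong₂ (λ a b → a + - c * b) (abel-binomial c x y N) ∑Q ⟩
    z ^ N + - c * (+ N * z ^ m)                      ≡⟨ collapse x y c (+ N) (z ^ m) ⟩
    (x + y) * z ^ m                                  ∎
    where
    N = suc m
    z = x + y + c * + N
    w : ℕ → ℤ
    w k = y + c * + (N ∸ k)
    P Q R : ℕ → ℤ
    P k = + (N C k) * (abel c x k * w k ^ (N ∸ k))
    Q k = + (N C k) * (abel c x k * (+ (N ∸ k) * w k ^ (N ∸ k ∸ 1)))
    R k = + (m C k) * (abel c x k * w k ^ (N ∸ k ∸ 1))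

    split : ∀ k → + (N C k) * (abel c x k * abel c y (N ∸ k)) ≡ P k + - c * Q k
    split k = trans (cong (λ t → + (N C k) * (abel c x k * t)) (abel-split c y (N ∸ k)))
                    (distrib c (+ (N C k)) (abel c x k) (w k ^ (N ∸ k)) (+ (N ∸ k) * w k ^ (N ∸ k ∸ 1)))
      where
      distrib : ∀ c b a p q → b * (a * (p + - (c * q))) ≡ b * (a * p) + - c * (b * (a * q))
      distrib = solve-∀

    Q≡N*R : ∀ k → Q k ≡ + N * R k
    Q≡N*R k = begin
      + (N C k) * (abel c x k * (+ (N ∸ k) * p))   ≡⟨ regroup (+ (N C k)) (abel c x k) (+ (N ∸ k)) p ⟩
      + (N ∸ k) * + (N C k) * (abel c x k * p)     ≡⟨ cong (_* (abel c x k * p)) absorbℤ ⟩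
      + N * + (m C k) * (abel c x k * p)           ≡⟨ *-assoc (+ N) (+ (m C k)) (abel c x k * p) ⟩
      + N * R k                                    ∎
      where
      p = w k ^ (N ∸ k ∸ 1)
      regroup : ∀ b a d p → b * (a * (d * p)) ≡ d * b * (a * p)
      regroup = solve-∀
      absorbℤ : + (N ∸ k) * + (N C k) ≡ + N * + (m C k)
      absorbℤ = trans (sym (pos-* (N ∸ k) (N C k))) (trans (cong +_ (C-∸-absorb m k)) (pos-* N (m C k)))

    R≡ : ∀ k → k ≤ m → R k ≡ + (m C k) * (abel c x k * ((y + c) + c * + (m ∸ k)) ^ (m ∸ k))
    R≡ k k≤m = begin
      + (m C k) * (abel c x k * (y + c * + (N ∸ k)) ^ (N ∸ k ∸ 1))
        ≡⟨ cong (λ e → + (m C k) * (abel c x k * (y + c * + e) ^ (e ∸ 1))) (ℕ.+-∸-assoc 1 k≤m) ⟩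
      + (m C k) * (abel c x k * (y + c * + suc (m ∸ k)) ^ (m ∸ k))
        ≡⟨ cong (λ t → + (m C k) * (abel c x k * t ^ (m ∸ k))) (shift y c (+ (m ∸ k))) ⟩
      + (m C k) * (abel c x k * ((y + c) + c * + (m ∸ k)) ^ (m ∸ k)) ∎
      where
      shift : ∀ y c e → y + c * (1ℤ + e) ≡ (y + c) + c * e
      shift = solve-∀

    ∑Q : ∑ (suc N) Q ≡ + N * z ^ m
    ∑Q = begin
      ∑ (suc N) Q                    ≡⟨ ∑-cong (suc N) (λ {k} _ → Q≡N*R k) ⟩
      ∑[ k < suc N ] (+ N * R k)     ≡⟨ *-distribˡ-∑ (+ N) (suc N) R ⟨
      + N * ∑ (suc N) R              ≡⟨ cong (+ N *_) (∑-C-extend (λ k → abel c x k * w k ^ (N ∸ k ∸ 1)) (ℕ.n≤1+n m)) ⟩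
      + N * ∑ (suc m) R              ≡⟨ cong (+ N *_) (∑-cong (suc m) (λ {k} k<1+m → R≡ k (ℕ.≤-pred k<1+m))) ⟩
      + N * ∑[ k < suc m ] (+ (m C k) * (abel c x k * ((y + c) + c * + (m ∸ k)) ^ (m ∸ k)))
                                     ≡⟨ cong (+ N *_) (abel-binomial c x (y + c) m) ⟩
      + N * (x + (y + c) + c * + m) ^ m ≡⟨ cong (λ t → + N * t ^ m) (reassoc x y c (+ m)) ⟩
      + N * z ^ m                    ∎
      where
      reassoc : ∀ x y c m → x + (y + c) + c * m ≡ x + y + c * (1ℤ + m)
      reassoc = solve-∀

    collapse : ∀ x y c N q → (x + y + c * N) * q + - c * (N * q) ≡ (x + y) * q
    collapse = solve-∀

  rhs-numerator≡abel : ∀ k → + rhs-numerator k ≡ abel (+ 2) 1ℤ k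
  rhs-numerator≡abel zero    = refl
  rhs-numerator≡abel (suc j) = begin
    + ((2 ℕ.* suc j ℕ.+ 1) ℕ.^ j) ≡⟨ pos-^ (2 ℕ.* suc j ℕ.+ 1) j ⟩
    (+ (2 ℕ.* suc j ℕ.+ 1)) ^ j   ≡⟨ cong (_^ j) cast ⟩
    (1ℤ + + 2 * + suc j) ^ j      ≡⟨ *-identityˡ _ ⟨
    1ℤ * (1ℤ + + 2 * + suc j) ^ j ∎
    where
    cast : + (2 ℕ.* suc j ℕ.+ 1) ≡ 1ℤ + + 2 * + suc j
    cast = trans (pos-+ (2 ℕ.* suc j) 1) (trans (cong (_+ 1ℤ) (pos-* 2 (suc j))) (+-comm (+ 2 * + suc j) 1ℤ))

  abel-2-2-*-suc : ∀ n → abel (+ 2) (+ 2) n * + suc n ≡ (+ 2 * + suc n) ^ n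
  abel-2-2-*-suc zero    = refl
  abel-2-2-*-suc (suc m) = begin
    + 2 * (+ 2 + + 2 * + suc m) ^ m * + N    ≡⟨ cong (λ t → + 2 * t ^ m * + N) (double-suc (+ m)) ⟩
    + 2 * (+ 2 * + N) ^ m * + N              ≡⟨ regroup (+ N) ((+ 2 * + N) ^ m) ⟩
    + 2 * + N * (+ 2 * + N) ^ m              ∎
    where
    N = suc (suc m)
    double-suc : ∀ m → + 2 + + 2 * (1ℤ + m) ≡ + 2 * (1ℤ + (1ℤ + m))
    double-suc = solve-∀
    regroup : ∀ N p → + 2 * p * N ≡ + 2 * N * p
    regroup = solve-∀

  rhs-numerator-convolution : ∀ n →
    ∑[ k < suc n ] (+ (n C k) * (+ rhs-numerator k * + rhs-numerator (n ∸ k))) * + suc n ≡ (+ 2 * + suc n) ^ n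
  rhs-numerator-convolution n = begin
    ∑[ k < suc n ] (+ (n C k) * (+ rhs-numerator k * + rhs-numerator (n ∸ k))) * + suc n
      ≡⟨ cong (_* + suc n) (∑-cong (suc n) (λ {k} _ → cong (+ (n C k) *_)
           (cong₂ _*_ (rhs-numerator≡abel k) (rhs-numerator≡abel (n ∸ k))))) ⟩
    ∑[ k < suc n ] (+ (n C k) * (abel (+ 2) 1ℤ k * abel (+ 2) 1ℤ (n ∸ k))) * + suc n
      ≡⟨ cong (_* + suc n) (abel-convolution (+ 2) 1ℤ 1ℤ n) ⟩
    abel (+ 2) (+ 2) n * + suc n ≡⟨ abel-2-2-*-suc n ⟩
    (+ 2 * + suc n) ^ n          ∎

module Fractions where

  open import Data.Integer as ℤ using (ℤ; +_)
  import Data.Integer.Properties as ℤ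
  open import Data.Rational using (ℚ; _/_; _+_; _*_; fromℚᵘ)
  open import Data.Rational.Properties
  open import Data.Rational.Unnormalised as ℚᵘ using (mkℚᵘ; *≡*)
  import Data.Rational.Unnormalised.Properties as ℚᵘ
  open import Relation.Binary.PropositionalEquality using (refl; trans; cong)

  fromℚᵘ-homo-* : ∀ p q → fromℚᵘ p * fromℚᵘ q ≡ fromℚᵘ (p ℚᵘ.* q)
  fromℚᵘ-homo-* p q = toℚᵘ-injective (ℚᵘ.≃-trans (toℚᵘ-homo-* (fromℚᵘ p) (fromℚᵘ q))
    (ℚᵘ.≃-trans (ℚᵘ.*-cong (toℚᵘ-fromℚᵘ p) (toℚᵘ-fromℚᵘ q)) (ℚᵘ.≃-sym (toℚᵘ-fromℚᵘ (p ℚᵘ.* q)))))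

  fromℚᵘ-homo-+ : ∀ p q → fromℚᵘ p + fromℚᵘ q ≡ fromℚᵘ (p ℚᵘ.+ q)
  fromℚᵘ-homo-+ p q = toℚᵘ-injective (ℚᵘ.≃-trans (toℚᵘ-homo-+ (fromℚᵘ p) (fromℚᵘ q))
    (ℚᵘ.≃-trans (ℚᵘ.+-cong (toℚᵘ-fromℚᵘ p) (toℚᵘ-fromℚᵘ q)) (ℚᵘ.≃-sym (toℚᵘ-fromℚᵘ (p ℚᵘ.+ q)))))

  -- i / suc d is definitionally fromℚᵘ (mkℚᵘ i d), so the following reduce to ℚᵘ arithmetic.
  /-cross : ∀ i j d e .{{_ : ℕ.NonZero d}} .{{_ : ℕ.NonZero e}} → i ℤ.* + e ≡ j ℤ.* + d → i / d ≡ j / e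
  /-cross i j (suc d) (suc e) eq = fromℚᵘ-cong {mkℚᵘ i d} {mkℚᵘ j e} (*≡* eq)

  /-*-/ : ∀ i j d e .{{_ : ℕ.NonZero d}} .{{_ : ℕ.NonZero e}} →
          (i / d) * (j / e) ≡ ((i ℤ.* j) / (d ℕ.* e)) {{ℕ.m*n≢0 d e}}
  /-*-/ i j (suc d) (suc e) = fromℚᵘ-homo-* (mkℚᵘ i d) (mkℚᵘ j e)

  /-+-/ : ∀ i j d e .{{_ : ℕ.NonZero d}} .{{_ : ℕ.NonZero e}} →
          (i / d) + (j / e) ≡ ((i ℤ.* + e ℤ.+ j ℤ.* + d) / (d ℕ.* e)) {{ℕ.m*n≢0 d e}}
  /-+-/ i j (suc d) (suc e) = fromℚᵘ-homo-+ (mkℚᵘ i d) (mkℚᵘ j e)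

  /-^ : ∀ i d k .{{_ : ℕ.NonZero d}} → (i / d) ^ℚ k ≡ ((i ℤ.^ k) / (d ℕ.^ k)) {{ℕ.m^n≢0 d k}}
  /-^ i d zero    = refl
  /-^ i d (suc k) = trans (cong ((i / d) *_) (/-^ i d k)) (/-*-/ i (i ℤ.^ k) d (d ℕ.^ k) {{_}} {{ℕ.m^n≢0 d k}})

module HookSums where

  open import Data.Integer as ℤ using (ℤ; +_)
  import Data.Integer.Properties as ℤ
  open import Data.Integer.Tactic.RingSolver using (solve-∀)
  open import Data.List using (List; []; _∷_; _++_; concatMap; applyUpTo; upTo)
  open import Data.List.Properties using (map-++; map-∘; map-cong-local)
  open import Data.List.Relation.Unary.All as All using (All; []; _∷_)
  open import Data.List.Relation.Unary.All.Properties using (concat⁺; map⁺; applyUpTo⁺₁)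
  open import Data.Rational using (ℚ; _/_; _+_; _*_; 1ℚ)
  open import Data.Rational.Properties
  open import Relation.Binary.PropositionalEquality using (refl; sym; trans; cong; cong₂; module ≡-Reasoning)
  open ≡-Reasoning
  open BinomialCoefficients using (C-factorial)
  open AbelIdentities using (pos-^; rhs-numerator-convolution)
  private module ℤ-Sum = FiniteSum ℤ.+-*-commutativeSemiring
  open FiniteSum (CommutativeRing.commutativeSemiring +-*-commutativeRing) using (∑; ∑-cong; *-distribˡ-∑)
  open Fractions

  ∑-/ : ∀ m (f : ℕ → ℤ) d .{{_ : ℕ.NonZero d}} → ∑[ k < m ] (f k / d) ≡ ℤ-Sum.∑ m f / d
  ∑-/ zero    f d = sym (0/n≡0 d)
  ∑-/ (suc m) f d = begin
    f 0 / d + ∑[ k < m ] (f (suc k) / d)                    ≡⟨ cong (λ q → f 0 / d + q) (∑-/ m (f ∘ suc) d) ⟩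
    f 0 / d + S / d                                         ≡⟨ /-+-/ (f 0) S d d ⟩
    ((f 0 ℤ.* + d ℤ.+ S ℤ.* + d) / (d ℕ.* d)) {{ℕ.m*n≢0 d d}} ≡⟨ /-cross (f 0 ℤ.* + d ℤ.+ S ℤ.* + d) (f 0 ℤ.+ S) (d ℕ.* d) d {{ℕ.m*n≢0 d d}} cross ⟩
    (f 0 ℤ.+ S) / d                                         ∎
    where
    S = ℤ-Sum.∑ m (f ∘ suc)
    cross : (f 0 ℤ.* + d ℤ.+ S ℤ.* + d) ℤ.* + d ≡ (f 0 ℤ.+ S) ℤ.* + (d ℕ.* d)
    cross = trans (factor-out (f 0) S (+ d)) (cong ((f 0 ℤ.+ S) ℤ.*_) (sym (ℤ.pos-* d d)))
      where
      factor-out : ∀ a s d → (a ℤ.* d ℤ.+ s ℤ.* d) ℤ.* d ≡ (a ℤ.+ s) ℤ.* (d ℤ.* d)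
      factor-out = solve-∀

  rhs-* : ∀ {n k} → k ≤ n →
    rhs k * rhs (n ∸ k) ≡ ((+ (n C k) ℤ.* (+ rhs-numerator k ℤ.* + rhs-numerator (n ∸ k))) / (n !)) {{n ℕ.!≢0}}
  rhs-* {n} {k} k≤n = trans (/-*-/ (+ a) (+ b) (k !) ((n ∸ k) !))
    (/-cross (+ a ℤ.* + b) (+ (n C k) ℤ.* (+ a ℤ.* + b)) (k ! ℕ.* (n ∸ k) !) (n !) (begin
      + a ℤ.* + b ℤ.* + (n !)                             ≡⟨ cong (λ m → + a ℤ.* + b ℤ.* + m) (C-factorial k≤n) ⟨
      + a ℤ.* + b ℤ.* + ((n C k) ℕ.* (k ! ℕ.* (n ∸ k) !)) ≡⟨ cong (+ a ℤ.* + b ℤ.*_) (ℤ.pos-* (n C k) (k ! ℕ.* (n ∸ k) !)) ⟩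
      + a ℤ.* + b ℤ.* (+ (n C k) ℤ.* + (k ! ℕ.* (n ∸ k) !)) ≡⟨ regroup (+ a) (+ b) (+ (n C k)) (+ (k ! ℕ.* (n ∸ k) !)) ⟩
      + (n C k) ℤ.* (+ a ℤ.* + b) ℤ.* + (k ! ℕ.* (n ∸ k) !) ∎))
    where
    a = rhs-numerator k
    b = rhs-numerator (n ∸ k)
    instance
      _ = n ℕ.!≢0
      _ = k ℕ.!≢0
      _ = (n ∸ k) ℕ.!≢0
      _ = ℕ.m*n≢0 (k !) ((n ∸ k) !)
    regroup : ∀ a b c f → a ℤ.* b ℤ.* (c ℤ.* f) ≡ c ℤ.* (a ℤ.* b) ℤ.* f
    regroup = solve-∀

  factor≡fraction : ∀ n → factor n ≡ (((+ (2 ℕ.* suc n ℕ.+ 1)) ℤ.^ n) / ((2 ℕ.* suc n) ℕ.^ n)) {{ℕ.m^n≢0 (2 ℕ.* suc n) n}}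
  factor≡fraction n = trans (cong (_^ℚ n) one-plus) (/-^ (+ (D ℕ.+ 1)) D n)
    where
    D = 2 ℕ.* suc n
    one-plus : 1ℚ + + 1 / D ≡ + (D ℕ.+ 1) / D
    one-plus = trans (/-+-/ (+ 1) (+ 1) 1 D) (/-cross (+ 1 ℤ.* + D ℤ.+ + 1 ℤ.* + 1) (+ (D ℕ.+ 1)) (1 ℕ.* D) D (begin
      (+ 1 ℤ.* + D ℤ.+ + 1 ℤ.* + 1) ℤ.* + D ≡⟨ regroup (+ D) ⟩
      (+ D ℤ.+ + 1) ℤ.* (+ 1 ℤ.* + D)       ≡⟨ cong₂ ℤ._*_ (ℤ.pos-+ D 1) (ℤ.pos-* 1 D) ⟨
      + (D ℕ.+ 1) ℤ.* + (1 ℕ.* D)           ∎))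
      where
      regroup : ∀ d → (+ 1 ℤ.* d ℤ.+ + 1 ℤ.* + 1) ℤ.* d ≡ (d ℤ.+ + 1) ℤ.* (+ 1 ℤ.* d)
      regroup = solve-∀

  rhs-recurrence : ∀ n → factor n * ∑[ k < suc n ] (rhs k * rhs (n ∸ k)) ≡ rhs (suc n)
  rhs-recurrence n = begin
    factor n * ∑[ k < suc n ] (rhs k * rhs (n ∸ k))    ≡⟨ cong (factor n *_) (∑-cong (suc n) (λ k<1+n → rhs-* (ℕ.≤-pred k<1+n))) ⟩
    factor n * ∑[ k < suc n ] (T k / n !)              ≡⟨ cong₂ _*_ (factor≡fraction n) (∑-/ (suc n) T (n !)) ⟩
    (A ℤ.^ n / D ℕ.^ n) * (S / n !)                    ≡⟨ /-*-/ (A ℤ.^ n) S (D ℕ.^ n) (n !) ⟩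
    (A ℤ.^ n ℤ.* S) / (D ℕ.^ n ℕ.* n !)                ≡⟨ /-cross (A ℤ.^ n ℤ.* S) (+ ((D ℕ.+ 1) ℕ.^ n)) (D ℕ.^ n ℕ.* n !) (suc n !) cross ⟩
    rhs (suc n)                                        ∎
    where
    N = suc n
    D = 2 ℕ.* N
    A = + (D ℕ.+ 1)
    T : ℕ → ℤ
    T k = + (n C k) ℤ.* (+ rhs-numerator k ℤ.* + rhs-numerator (n ∸ k))
    S = ℤ-Sum.∑ (suc n) T
    instance
      _ = n ℕ.!≢0
      _ = N ℕ.!≢0
      _ = ℕ.m^n≢0 D n
      _ = ℕ.m*n≢0 (D ℕ.^ n) (n !)
    cross : A ℤ.^ n ℤ.* S ℤ.* + (N !) ≡ + ((D ℕ.+ 1) ℕ.^ n) ℤ.* + (D ℕ.^ n ℕ.* n !)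
    cross = begin
      A ℤ.^ n ℤ.* S ℤ.* + (N ℕ.* n !)               ≡⟨ cong (A ℤ.^ n ℤ.* S ℤ.*_) (ℤ.pos-* N (n !)) ⟩
      A ℤ.^ n ℤ.* S ℤ.* (+ N ℤ.* + (n !))           ≡⟨ regroup (A ℤ.^ n) S (+ N) (+ (n !)) ⟩
      A ℤ.^ n ℤ.* (S ℤ.* + N ℤ.* + (n !))           ≡⟨ cong (λ t → A ℤ.^ n ℤ.* (t ℤ.* + (n !))) (rhs-numerator-convolution n) ⟩
      A ℤ.^ n ℤ.* ((+ 2 ℤ.* + N) ℤ.^ n ℤ.* + (n !)) ≡⟨ cong (λ t → A ℤ.^ n ℤ.* (t ℤ.^ n ℤ.* + (n !))) (ℤ.pos-* 2 N) ⟨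
      A ℤ.^ n ℤ.* ((+ D) ℤ.^ n ℤ.* + (n !))         ≡⟨ cong₂ (λ a d → a ℤ.* (d ℤ.* + (n !))) (pos-^ (D ℕ.+ 1) n) (pos-^ D n) ⟨
      + ((D ℕ.+ 1) ℕ.^ n) ℤ.* (+ (D ℕ.^ n) ℤ.* + (n !)) ≡⟨ cong (+ ((D ℕ.+ 1) ℕ.^ n) ℤ.*_) (ℤ.pos-* (D ℕ.^ n) (n !)) ⟨
      + ((D ℕ.+ 1) ℕ.^ n) ℤ.* + (D ℕ.^ n ℕ.* n !)   ∎
      where
      regroup : ∀ a s m f → a ℤ.* s ℤ.* (m ℤ.* f) ≡ a ℤ.* (s ℤ.* m ℤ.* f)
      regroup = solve-∀

  sumℚ-++ : ∀ xs ys → sumℚ (xs ++ ys) ≡ sumℚ xs + sumℚ ys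
  sumℚ-++ []       ys = sym (+-identityˡ (sumℚ ys))
  sumℚ-++ (x ∷ xs) ys = trans (cong (λ q → x + q) (sumℚ-++ xs ys)) (sym (+-assoc x (sumℚ xs) (sumℚ ys)))

  sumℚ-concatMap : ∀ {A B : Set} (h : B → ℚ) (f : A → List B) xs →
                   sumℚ (map h (concatMap f xs)) ≡ sumℚ (map (λ x → sumℚ (map h (f x))) xs)
  sumℚ-concatMap h f []       = refl
  sumℚ-concatMap h f (x ∷ xs) = begin
    sumℚ (map h (f x ++ concatMap f xs))                ≡⟨ cong sumℚ (map-++ h (f x) (concatMap f xs)) ⟩
    sumℚ (map h (f x) ++ map h (concatMap f xs))        ≡⟨ sumℚ-++ (map h (f x)) _ ⟩
    sumℚ (map h (f x)) + sumℚ (map h (concatMap f xs))  ≡⟨ cong (λ q → sumℚ (map h (f x)) + q) (sumℚ-concatMap h f xs) ⟩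
    sumℚ (map h (f x)) + sumℚ (map (λ x → sumℚ (map h (f x))) xs) ∎

  sumℚ-*ˡ : ∀ {A : Set} q (f : A → ℚ) xs → sumℚ (map (λ x → q * f x) xs) ≡ q * sumℚ (map f xs)
  sumℚ-*ˡ q f []       = sym (*-zeroʳ q)
  sumℚ-*ˡ q f (x ∷ xs) = trans (cong (λ r → q * f x + r) (sumℚ-*ˡ q f xs)) (sym (*-distribˡ-+ q (f x) _))

  sumℚ-*ʳ : ∀ {A : Set} q (f : A → ℚ) xs → sumℚ (map (λ x → f x * q) xs) ≡ sumℚ (map f xs) * q
  sumℚ-*ʳ q f []       = sym (*-zeroˡ q)
  sumℚ-*ʳ q f (x ∷ xs) = trans (cong (λ r → f x * q + r) (sumℚ-*ʳ q f xs)) (sym (*-distribʳ-+ q (f x) _))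

  sumℚ-applyUpTo : ∀ (h : ℕ → ℚ) f m → sumℚ (map h (applyUpTo f m)) ≡ ∑[ k < m ] h (f k)
  sumℚ-applyUpTo h f zero    = refl
  sumℚ-applyUpTo h f (suc m) = cong (λ q → h (f 0) + q) (sumℚ-applyUpTo h (f ∘ suc) m)

  treesF-size : ∀ fuel n → All (λ t → size t ≡ n) (treesF fuel n)
  treesF-size _          zero    = refl ∷ []
  treesF-size zero       (suc n) = []
  treesF-size (suc fuel) (suc n) = concat⁺ (map⁺ (applyUpTo⁺₁ id (suc n) λ {k} k<1+n →
    concat⁺ (map⁺ (All.map (λ {l} size-l → map⁺ {f = node l} (All.map (λ size-r →
      cong suc (trans (cong₂ ℕ._+_ size-l size-r) (ℕ.m+[n∸m]≡n (ℕ.≤-pred k<1+n))))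
      (treesF-size fuel (n ∸ k)))) (treesF-size fuel k)))))

  hookSum : ℕ → ℕ → ℚ
  hookSum fuel n = sumℚ (map hookProd (treesF fuel n))

  hookSum-suc : ∀ fuel n → hookSum (suc fuel) (suc n) ≡ ∑[ k < suc n ] (factor n * (hookSum fuel k * hookSum fuel (n ∸ k)))
  hookSum-suc fuel n = begin
    sumℚ (map hookProd (concatMap split (upTo (suc n))))
      ≡⟨ sumℚ-concatMap hookProd split (upTo (suc n)) ⟩
    sumℚ (map (λ k → sumℚ (map hookProd (split k))) (upTo (suc n)))
      ≡⟨ sumℚ-applyUpTo (λ k → sumℚ (map hookProd (split k))) id (suc n) ⟩
    ∑[ k < suc n ] sumℚ (map hookProd (split k))
      ≡⟨ ∑-cong (suc n) (λ k<1+n → split-sum (ℕ.≤-pred k<1+n)) ⟩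
    ∑[ k < suc n ] (factor n * (hookSum fuel k * hookSum fuel (n ∸ k))) ∎
    where
    split : ℕ → List BTree
    split k = concatMap (λ l → map (node l) (treesF fuel (n ∸ k))) (treesF fuel k)

    split-sum : ∀ {k} → k ≤ n → sumℚ (map hookProd (split k)) ≡ factor n * (hookSum fuel k * hookSum fuel (n ∸ k))
    split-sum {k} k≤n = begin
      sumℚ (map hookProd (split k))                            ≡⟨ sumℚ-concatMap hookProd (λ l → map (node l) R) L ⟩
      sumℚ (map (λ l → sumℚ (map hookProd (map (node l) R))) L) ≡⟨ cong sumℚ (map-cong-local (All.map right-sum (treesF-size fuel k))) ⟩
      sumℚ (map (λ l → factor n * hookProd l * hookSum fuel (n ∸ k)) L)
        ≡⟨ sumℚ-*ʳ (hookSum fuel (n ∸ k)) (λ l → factor n * hookProd l) L ⟩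
      sumℚ (map (λ l → factor n * hookProd l) L) * hookSum fuel (n ∸ k)
        ≡⟨ cong (_* hookSum fuel (n ∸ k)) (sumℚ-*ˡ (factor n) hookProd L) ⟩
      factor n * hookSum fuel k * hookSum fuel (n ∸ k)         ≡⟨ *-assoc (factor n) (hookSum fuel k) (hookSum fuel (n ∸ k)) ⟩
      factor n * (hookSum fuel k * hookSum fuel (n ∸ k))       ∎
      where
      L = treesF fuel k
      R = treesF fuel (n ∸ k)
      right-sum : ∀ {l} → size l ≡ k → sumℚ (map hookProd (map (node l) R)) ≡ factor n * hookProd l * hookSum fuel (n ∸ k)
      right-sum {l} size-l = begin
        sumℚ (map hookProd (map (node l) R))                   ≡⟨ cong sumℚ (map-∘ R) ⟨
        sumℚ (map (hookProd ∘ node l) R)                       ≡⟨ cong sumℚ (map-cong-local (All.map node-hookProd (treesF-size fuel (n ∸ k)))) ⟩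
        sumℚ (map (λ r → factor n * hookProd l * hookProd r) R) ≡⟨ sumℚ-*ˡ (factor n * hookProd l) hookProd R ⟩
        factor n * hookProd l * hookSum fuel (n ∸ k)           ∎
        where
        node-hookProd : ∀ {r} → size r ≡ n ∸ k → hookProd (node l r) ≡ factor n * hookProd l * hookProd r
        node-hookProd {r} size-r = trans
          (cong (λ m → factor m * (hookProd l * hookProd r)) (trans (cong₂ ℕ._+_ size-l size-r) (ℕ.m+[n∸m]≡n k≤n)))
          (sym (*-assoc (factor n) (hookProd l) (hookProd r)))

  hookSum≡rhs : ∀ {fuel n} → n ≤ fuel → hookSum fuel n ≡ rhs n
  hookSum≡rhs {_}        {zero}  _            = refl
  hookSum≡rhs {suc fuel} {suc n} (s≤s n≤fuel) = begin
    hookSum (suc fuel) (suc n)                                           ≡⟨ hookSum-suc fuel n ⟩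
    ∑[ k < suc n ] (factor n * (hookSum fuel k * hookSum fuel (n ∸ k))) ≡⟨ ∑-cong (suc n) (λ {k} k<1+n → cong (factor n *_)
      (cong₂ _*_ (hookSum≡rhs (ℕ.≤-trans (ℕ.≤-pred k<1+n) n≤fuel)) (hookSum≡rhs (ℕ.≤-trans (ℕ.m∸n≤m n k) n≤fuel)))) ⟩
    ∑[ k < suc n ] (factor n * (rhs k * rhs (n ∸ k)))                   ≡⟨ *-distribˡ-∑ (factor n) (suc n) (λ k → rhs k * rhs (n ∸ k)) ⟨
    factor n * ∑[ k < suc n ] (rhs k * rhs (n ∸ k))                     ≡⟨ rhs-recurrence n ⟩
    rhs (suc n)                                                          ∎

open HookSums using (hookSum≡rhs)

corollary2 : (n : ℕ) → 1 ≤ n → sumℚ (map hookProd (𝓑 n)) ≡ rhs n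
corollary2 n _ = hookSum≡rhs (ℕ.≤-refl {n})
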